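{- Let $m\ge s\ge 1$ be integers, let $n=2^{m+s}-2^m+2^s$, and let $D$ be a Steiner $2$-$(n,2^s,1)$ design with block-by-point incidence matrix $A$. Let $C$ be the binary linear code of length $n$ spanned by the rows of $A$ over $GF(2)$, and let $C^\perp$ be its dual code. Then: (i) The all-one vector $\bar{1}=(1,\ldots,1)$ belongs to $C\cap C^\perp$. (ii) The dual code $C^\perp$ admits majority-logic decoding (using the rows of $A$ as parity checks) that corrects up to $t=2^{m-1}$ errors. (iii) The minimum distance $d^\perp$ of $C^\perp$ is an even number; it equals $2^m+2$ if $D$ contains hyperovals, and $d^\perp\ge 2^m+4$ if $D$ has no hyperovals. (iv) The minimum distance $d$ of $C$ is an even number with $d\le 2^s$. (v) The dimension of $C$, i.e. the $2$-rank $\mathrm{rank}_2 A$ of $A$, satisfies \[ 1+\left\lceil \log_2\Big(\sum_{i=0}^{t}\binom{n-1}{i}\Big)\right\rceil \le \mathrm{rank}_2 A \le n-1-\left\lfloor \log_2\Big(\sum_{i=0}^{d/2-1}\binom{n-1}{i}\Big)\right\rfloor, \] where $t=2^{m-1}$ if $d^\perp=2^m+2$, and $t=d^\perp/2-1$ if $d^\perp\ge 2^m+4$.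
   Context: A Steiner $2$-$(v,k,1)$ design is a pair $\{X,B\}$ of a set $X$ of $v$ points and a collection $B$ of $k$-subsets (blocks) such that every two distinct points lie in exactly one block; each point lies in $r=(v-1)/(k-1)$ blocks (here $r=2^m+1$). The incidence matrix has rows indexed by blocks, columns by points, with entry $1$ iff the block contains the point. An oval of $D$ is a set of points meeting every block in at most two points; a hyperoval of $D$ is an oval of size $r+1$ (equivalently, a set of $r+1$ points meeting every block in $0$ or $2$ points). -}

module Defs where

open import Data.Bool using (Bool; true; false; _xor_; _∧_; if_then_else_)
open import Data.Nat using (ℕ; zero; suc; _+_; _*_; _∸_; _^_; _≤_; _<ᵇ_)
open import Data.Fin using (Fin; zero; suc)
open import Data.Fin.Subset using (Subset; ∣_∣; _∈_; _∩_)
  renaming (⊥ to ∅; ⊤ to full)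
open import Data.Vec using (Vec; []; _∷_; zipWith; tabulate; lookup)
open import Data.List using (map; upTo)
open import Data.Nat.ListAction using (sum)
open import Data.Nat.Combinatorics using (_C_)
open import Data.Product using (Σ; ∃; ∃!; _×_)
open import Relation.Binary.PropositionalEquality using (_≡_; _≢_)
open import Relation.Nullary using (¬_)

steinerLength : ℕ → ℕ → ℕ
steinerLength m s = 2 ^ (m + s) ∸ 2 ^ m + 2 ^ s

-- A Steiner 2-(v,k,1) design on the point set Fin v, with b blocks
-- indexed by Fin b; block i is given as its characteristic vector,
-- which is also row i of the block-by-point incidence matrix A.
record Steiner2Design (v k : ℕ) : Set where
  field
    b          : ℕ
    block      : Fin b → Subset v
    block-size : ∀ i → ∣ block i ∣ ≡ k
    pair-unique : ∀ (x y : Fin v) → x ≢ y →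
                  ∃! _≡_ (λ i → x ∈ block i × y ∈ block i)

open Steiner2Design public

Word : ℕ → Set
Word n = Subset n

_⊕_ : ∀ {n} → Word n → Word n → Word n
_⊕_ = zipWith _xor_

parity : ∀ {n} → Vec Bool n → Bool
parity [] = false
parity (x ∷ xs) = x xor parity xs

dot : ∀ {n} → Word n → Word n → Bool
dot x y = parity (zipWith _∧_ x y)

lincomb : ∀ {n b} → (Fin b → Word n) → Vec Bool b → Word n
lincomb {b = zero} rows [] = ∅
lincomb {b = suc b} rows (c ∷ cs) =
  (if c then rows zero else ∅) ⊕ lincomb (λ i → rows (suc i)) cs

InSpan : ∀ {n b} → (Fin b → Word n) → Word n → Set
InSpan rows x = ∃ λ c → lincomb rows c ≡ x

InDual : ∀ {n} → (Word n → Set) → Word n → Set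
InDual P x = ∀ y → P y → dot x y ≡ false

Code : ∀ {v k} → Steiner2Design v k → Word v → Set
Code D = InSpan (block D)

DualCode : ∀ {v k} → Steiner2Design v k → Word v → Set
DualCode D = InDual (Code D)

MinDist : ∀ {n} → (Word n → Set) → ℕ → Set
MinDist P d =
  (∃ λ x → P x × x ≢ ∅ × ∣ x ∣ ≡ d) ×
  (∀ x → P x → x ≢ ∅ → d ≤ ∣ x ∣)

IsDim : ∀ {n} → (Word n → Set) → ℕ → Set
IsDim {n} P k = Σ (Fin k → Word n) λ basis →
  (∀ i → P (basis i)) ×
  (∀ c → lincomb basis c ≡ ∅ → c ≡ ∅) ×
  (∀ x → P x → ∃ λ c → lincomb basis c ≡ x)

Rank2 : ∀ {v k} → Steiner2Design v k → ℕ → Set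
Rank2 D r = IsDim (Code D) r

-- ovals and hyperovals (r = replication number of the design)
Oval : ∀ {v k} → Steiner2Design v k → Subset v → Set
Oval D H = ∀ i → ∣ H ∩ block D i ∣ ≤ 2

Hyperoval : ∀ {v k} → Steiner2Design v k → ℕ → Subset v → Set
Hyperoval D r H = Oval D H × ∣ H ∣ ≡ suc r

HasHyperoval : ∀ {v k} → Steiner2Design v k → ℕ → Set
HasHyperoval D r = ∃ λ H → Hyperoval D r H

-- One-step majority-logic decoder using the rows of A as parity checks:
-- bit j of the received word y is flipped iff strictly more than half
-- of the checks (blocks) containing j are violated (dot y B = 1).
numChecks : ∀ {v k} → Steiner2Design v k → Fin v → ℕ
numChecks D j = ∣ tabulate (λ i → lookup (block D i) j) ∣

numFailed : ∀ {v k} → Steiner2Design v k → Word v → Fin v → ℕ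
numFailed D y j = ∣ tabulate (λ i → lookup (block D i) j ∧ dot y (block D i)) ∣

majorityDecode : ∀ {v k} → Steiner2Design v k → Word v → Word v
majorityDecode D y =
  tabulate (λ j → lookup y j xor (numChecks D j <ᵇ 2 * numFailed D y j))

-- Σ_{i=0}^{k-1} binom(N, i)
binomSum : ℕ → ℕ → ℕ
binomSum N k = sum (map (λ i → N C i) (upTo k))

-- Each point lies on r = 2^m + 1 blocks (count the pairs through it) and two points share exactly one
-- block. Adding the blocks through a point gives the all-one vector since r is odd, and blocks have even
-- size 2^s, so 1 ∈ C ∩ C⊥ and all words of C and C⊥ have even weight. The r blocks through a point p are
-- parity checks meeting only in p; a word of C⊥ containing p meets each of them again, so d⊥ ≥ r + 1,
-- with equality exactly when the word meets every block in 0 or 2 points, i.e. is a hyperoval; the same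
-- checks decode bit p by majority vote whenever at most ⌊r/2⌋ = 2^(m-1) errors occur. The rank bounds
-- are sphere-packing counts: syndromes separate words of small weight on n − 1 coordinates (lower
-- bound), and the punctured code has disjoint balls of radius d/2 − 1 (upper bound).

module Submission where

open import Defs
open import Data.Nat using (ℕ; suc; _+_; _∸_; _^_; _≤_; _/_)
open import Data.Nat.Divisibility using (_∣_)
open import Data.Nat.Logarithm using (⌊log₂_⌋; ⌈log₂_⌉)
open import Data.Fin.Subset using (∣_∣) renaming (⊤ to full)
open import Data.Product using (Σ; _×_)
open import Relation.Binary.PropositionalEquality using (_≡_)
open import Relation.Nullary using (¬_)

open import Algebra.Bundles using (CommutativeRing)
open import Data.Bool as Bool using (Bool; true; false; not; _∧_; _xor_; if_then_else_)
open import Data.Bool.Properties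
  using (¬-not; not-distribˡ-xor; xor-same; xor-identityʳ; ∧-distribʳ-xor;
         ∧-zeroʳ; ∧-identityʳ; ∧-identityˡ; ∧-idem; ∧-comm; xor-comm; xor-assoc;
         not-involutive; T-≡; xor-∧-commutativeRing)
open import Data.Empty using (⊥)
open import Data.List using (List; []; _∷_; map; _++_; length; applyUpTo; cartesianProduct)
  renaming (lookup to lookupˡ)
open import Data.List.Membership.Propositional using (_∈_)
open import Data.List.Membership.Propositional.Properties 
  using (∈-map⁻; ∈-++⁻; ∈-lookup; ∈-cartesianProduct⁻)
open import Data.List.Properties using (length-map; length-++; map-upTo)
open import Data.Nat.Logarithm
  using (⌈log₂2*n⌉≡1+⌈log₂n⌉; ⌈log₂⌉-mono-≤; ⌈log₂2^n⌉≡n;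
         ⌊log₂[2*b]⌋≡1+⌊log₂b⌋; ⌊log₂⌋-mono-≤; ⌊log₂[2^n]⌋≡n)
open import Data.Nat.Combinatorics using (_C_; nCk+nC[k+1]≡[n+1]C[k+1])
open import Data.Nat.ListAction using () renaming (sum to sumˡ)
import Data.List.Relation.Unary.All as All
open import Data.List.Relation.Unary.Unique.Propositional using (Unique; []; _∷_)
import Data.List.Relation.Unary.Unique.Propositional.Properties as Unique
open import Data.Fin using (Fin; zero; suc; toℕ; combine; fromℕ<)
open import Data.Fin.Properties using (_≟_; any?; all?; combine-injective; injective⇒≤)
open import Data.Fin.Subset using (Subset; _∩_; ⁅_⁆) renaming (⊥ to ∅)
open import Data.Fin.Subset.Properties using (anySubset?; ∣⊤∣≡n; ∣⊥∣≡0)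
open import Data.Nat using (zero; pred; _*_; _<_; _<ᵇ_; z≤n; s≤s; NonZero; >-nonZero)
open import Data.Nat.Tactic.RingSolver using (solve-∀)
open import Data.Nat.Divisibility using (divides)
open import Data.Nat.DivMod using (m*n/n≡m)
open import Data.Nat.Properties hiding (_≟_)
open import Data.Product using (∃; _,_; proj₁; proj₂)
open import Data.Sum using (_⊎_; inj₁; inj₂; [_,_]′)
open import Data.Vec using (Vec; []; _∷_; lookup; tabulate; zipWith; tail)
open import Data.Vec.Properties
  using (∷-injectiveʳ; []=⇒lookup; lookup⇒[]=; lookup∘tabulate; lookup-zipWith; lookup-replicate;
         tabulate∘lookup; tabulate-cong;
         zipWith-identityˡ; zipWith-identityʳ; ≡-dec)
open import Function using (_∘_)
open import Function.Bundles using (Equivalence)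
open import Relation.Binary.PropositionalEquality
  using (_≢_; ≢-sym; _≗_; refl; sym; trans; cong; cong₂; subst; module ≡-Reasoning)
open import Relation.Nullary using (Dec; yes; no; does; contradiction; ¬?; _×-dec_)

open import Algebra.Properties.Semiring.Sum +-*-semiring
  using (sum; sum-syntax; sum-cong-≗; sum-replicate-zero; ∑-distrib-+; ∑-comm; *-distribʳ-sum)
open import Algebra.Properties.CommutativeSemigroup +-commutativeSemigroup using (x∙yz≈y∙xz)
open import Algebra.Properties.CommutativeSemigroup
  (CommutativeRing.+-commutativeSemigroup xor-∧-commutativeRing)
  using () renaming (interchange to xor-interchange)

-- Counting over finite index sets

bit : Bool → ℕ
bit false = 0
bit true  = 1

count : ∀ {n} → (Fin n → Bool) → ℕ
count {n} f = ∑[ i < n ] bit (f i)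

_≢ᵇ_ : ∀ {n} → Fin n → Fin n → Bool
q ≢ᵇ p = not (does (q ≟ p))

count-cong : ∀ {n} {f g : Fin n → Bool} → f ≗ g → count f ≡ count g
count-cong f≗g = sum-cong-≗ (cong bit ∘ f≗g)

count-false : ∀ {n} {f : Fin n → Bool} → (∀ i → f i ≡ false) → count f ≡ 0
count-false {n} f≡false = trans (sum-cong-≗ (cong bit ∘ f≡false)) (sum-replicate-zero n)

∑-mono-≤ : ∀ {n} {f g : Fin n → ℕ} → (∀ i → f i ≤ g i) → sum f ≤ sum g
∑-mono-≤ {zero}  _   = z≤n
∑-mono-≤ {suc n} f≤g = +-mono-≤ (f≤g zero) (∑-mono-≤ (f≤g ∘ suc))

∑-≤-≡⇒≗ : ∀ {n} {f g : Fin n → ℕ} → (∀ i → f i ≤ g i) → sum f ≡ sum g → f ≗ g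
∑-≤-≡⇒≗ {suc n} {f} {g} f≤g Σf≡Σg i with m≤n⇒m<n∨m≡n (f≤g zero)
... | inj₁ f₀<g₀ = contradiction Σf≡Σg (<⇒≢ (+-mono-<-≤ f₀<g₀ (∑-mono-≤ (f≤g ∘ suc))))
... | inj₂ f₀≡g₀ with i
...   | zero  = f₀≡g₀
...   | suc j = ∑-≤-≡⇒≗ (f≤g ∘ suc)
                  (+-cancelˡ-≡ (f zero) _ _ (trans Σf≡Σg (cong (_+ _) (sym f₀≡g₀)))) j

∑-guarded-≤-≡⇒≡ : ∀ {n} (a : Fin n → Bool) {f g : Fin n → ℕ} → (∀ i → a i ≡ true → f i ≤ g i) →
                  ∑[ i < n ] (bit (a i) * f i) ≡ ∑[ i < n ] (bit (a i) * g i) →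
                  ∀ i → a i ≡ true → f i ≡ g i
∑-guarded-≤-≡⇒≡ a {f} {g} f≤g Σ≡ i ai = trans (sym (*-identityˡ (f i)))
  (trans (subst (λ b → bit b * f i ≡ bit b * g i) ai (∑-≤-≡⇒≗ guarded Σ≡ i)) (*-identityˡ (g i)))
  where
  guarded : ∀ j → bit (a j) * f j ≤ bit (a j) * g j
  guarded j with a j in aj
  ... | false = z≤n
  ... | true  = *-monoʳ-≤ 1 (f≤g j aj)

count-remove : ∀ {n} (f : Fin n → Bool) (p : Fin n) →
               count f ≡ bit (f p) + count (λ q → q ≢ᵇ p ∧ f q)
count-remove {suc n} f zero    = refl
count-remove {suc n} f (suc p) = begin
  bit (f zero) + count (f ∘ suc)
    ≡⟨ cong (bit (f zero) +_) (count-remove (f ∘ suc) p) ⟩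
  bit (f zero) + (bit (f (suc p)) + count (λ q → q ≢ᵇ p ∧ f (suc q)))
    ≡⟨ x∙yz≈y∙xz (bit (f zero)) (bit (f (suc p))) _ ⟩
  bit (f (suc p)) + (bit (f zero) + count (λ q → q ≢ᵇ p ∧ f (suc q))) ∎
  where open ≡-Reasoning

count-single : ∀ {n} (f : Fin n → Bool) (p : Fin n) → f p ≡ true →
               (∀ q → f q ≡ true → q ≡ p) → count f ≡ 1
count-single f p fp≡true unique = trans (count-remove f p)
  (cong₂ _+_ (cong bit fp≡true) (count-false others-false))
  where
  others-false : ∀ q → q ≢ᵇ p ∧ f q ≡ false
  others-false q with f q in fq
  ... | false = ∧-zeroʳ (q ≢ᵇ p)
  ... | true with q ≟ p
  ...   | yes _   = refl
  ...   | no q≢p  = contradiction (unique q fq) q≢p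

some-true-or-all-false : ∀ {n} (f : Fin n → Bool) → (∃ λ p → f p ≡ true) ⊎ (∀ p → f p ≡ false)
some-true-or-all-false f with any? (λ p → f p Bool.≟ true)
... | yes some = inj₁ some
... | no none  = inj₂ λ p → ¬-not (λ fp≡true → none (p , fp≡true))

1≤count⇒∃ : ∀ {n} {f : Fin n → Bool} → 1 ≤ count f → ∃ λ i → f i ≡ true
1≤count⇒∃ {f = f} 1≤count with some-true-or-all-false f
... | inj₁ some      = some
... | inj₂ all-false = contradiction (count-false all-false) (≢-sym (<⇒≢ 1≤count))

bit-*-count : ∀ {n} b (f : Fin n → Bool) → bit b * count f ≡ count (λ q → b ∧ f q)
bit-*-count false f = sym (count-false {f = λ q → false ∧ f q} (λ _ → refl))
bit-*-count true  f = +-identityʳ (count f)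

count-∧-split : ∀ {n} (a f : Fin n → Bool) →
                count (λ i → a i ∧ f i) + count (λ i → a i ∧ not (f i)) ≡ count a
count-∧-split a f = trans (sym (∑-distrib-+ (λ i → bit (a i ∧ f i)) (λ i → bit (a i ∧ not (f i)))))
                          (sum-cong-≗ λ i → split (a i) (f i))
  where
  split : ∀ x y → bit (x ∧ y) + bit (x ∧ not y) ≡ bit x
  split false y     = refl
  split true  true  = refl
  split true  false = refl

∧≡true : ∀ {a b} → a ∧ b ≡ true → a ≡ true × b ≡ true
∧≡true {true} {true} _ = refl , refl


-- Parity

odd : ℕ → Bool
odd zero    = false
odd (suc n) = not (odd n)

odd-+ : ∀ a b → odd (a + b) ≡ odd a xor odd b
odd-+ zero    b = refl
odd-+ (suc a) b = trans (cong not (odd-+ a b)) (not-distribˡ-xor (odd a) (odd b))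

odd-bit+ : ∀ b n → odd (bit b + n) ≡ b xor odd n
odd-bit+ false n = refl
odd-bit+ true  n = refl

odd-double : ∀ a → odd (a + a) ≡ false
odd-double a = trans (odd-+ a a) (xor-same (odd a))

odd-count-xor : ∀ {n} (f g : Fin n → Bool) →
                odd (count (λ i → f i xor g i)) ≡ odd (count f) xor odd (count g)
odd-count-xor {zero}  f g = refl
odd-count-xor {suc n} f g = begin
  odd (bit (f zero xor g zero) + count (λ i → f (suc i) xor g (suc i)))
    ≡⟨ odd-bit+ (f zero xor g zero) _ ⟩
  (f zero xor g zero) xor odd (count (λ i → f (suc i) xor g (suc i)))
    ≡⟨ cong ((f zero xor g zero) xor_) (odd-count-xor (f ∘ suc) (g ∘ suc)) ⟩
  (f zero xor g zero) xor (odd (count (f ∘ suc)) xor odd (count (g ∘ suc)))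
    ≡⟨ xor-interchange (f zero) (g zero) _ _ ⟩
  (f zero xor odd (count (f ∘ suc))) xor (g zero xor odd (count (g ∘ suc)))
    ≡⟨ sym (cong₂ _xor_ (odd-bit+ (f zero) _) (odd-bit+ (g zero) _)) ⟩
  odd (count f) xor odd (count g) ∎
  where open ≡-Reasoning

bit-odd≤ : ∀ n → bit (odd n) ≤ n
bit-odd≤ zero    = z≤n
bit-odd≤ (suc n) = ≤-trans (bit≤1 (odd (suc n))) (s≤s z≤n)
  where
  bit≤1 : ∀ b → bit b ≤ 1
  bit≤1 false = z≤n
  bit≤1 true  = ≤-refl

odd≡true⇒≥1 : ∀ {n} → odd n ≡ true → 1 ≤ n
odd≡true⇒≥1 {suc n} _ = s≤s z≤n

odd≡false⇒double : ∀ d → odd d ≡ false → ∃ λ u → d ≡ u + u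
odd≡false⇒double zero          _      = 0 , refl
odd≡false⇒double (suc (suc d)) d-even with odd≡false⇒double d (trans (sym (not-involutive (odd d))) d-even)
... | u , refl = suc u , cong suc (sym (+-suc u u))

odd≡false⇒2∣ : ∀ {d} → odd d ≡ false → 2 ∣ d
odd≡false⇒2∣ {d} d-even with odd≡false⇒double d d-even
... | u , refl = divides u (trans (cong (u +_) (sym (+-identityʳ u))) (*-comm 2 u))

even-split : ∀ {d} → odd d ≡ false → 1 ≤ d → ∃ λ u → d ≡ 2 + (u + u)
even-split {d} d-even 1≤d with odd≡false⇒double d d-even
... | suc u , refl = u , cong suc (+-suc u u)

[2+u+u]/2 : ∀ u → (2 + (u + u)) / 2 ≡ suc u
[2+u+u]/2 u = trans (cong (_/ 2) (2+u+u≡[1+u]*2 u)) (m*n/n≡m (suc u) 2)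
  where
  2+u+u≡[1+u]*2 : ∀ u → 2 + (u + u) ≡ suc u * 2
  2+u+u≡[1+u]*2 = solve-∀

even-gap : ∀ {a d} → odd a ≡ false → odd d ≡ false → a ≤ d → a ≢ d → 2 + a ≤ d
even-gap {a} a-even d-even a≤d a≢d with m≤n⇒m<n∨m≡n a≤d
... | inj₂ a≡d = contradiction a≡d a≢d
... | inj₁ a<d with m≤n⇒m<n∨m≡n a<d
...   | inj₁ 1+a<d = 1+a<d
...   | inj₂ refl  = contradiction (trans (sym d-even) (cong not a-even)) λ ()

xor≡false⇒≡ : ∀ {a b} → a xor b ≡ false → a ≡ b
xor≡false⇒≡ {false} {false} _ = refl
xor≡false⇒≡ {true}  {true}  _ = refl

xor-swap : ∀ {a b a′ b′} → a xor b ≡ a′ xor b′ → a xor a′ ≡ b xor b′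
xor-swap {a} {b} {a′} {b′} eq = xor≡false⇒≡ (begin
  (a xor a′) xor (b xor b′)   ≡⟨ xor-interchange a a′ b b′ ⟩
  (a xor b) xor (a′ xor b′)   ≡⟨ cong (_xor (a′ xor b′)) eq ⟩
  (a′ xor b′) xor (a′ xor b′) ≡⟨ xor-same (a′ xor b′) ⟩
  false                       ∎)
  where open ≡-Reasoning


-- Binary words, weight and inner product

lookup-ext : ∀ {A : Set} {n} {x y : Vec A n} → (∀ i → lookup x i ≡ lookup y i) → x ≡ y
lookup-ext {x = x} {y} x≗y = trans (sym (tabulate∘lookup x)) (trans (tabulate-cong x≗y) (tabulate∘lookup y))

∣∣-count : ∀ {n} (x : Subset n) → ∣ x ∣ ≡ count (lookup x)
∣∣-count []          = refl
∣∣-count (true ∷ x)  = cong suc (∣∣-count x)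
∣∣-count (false ∷ x) = ∣∣-count x

∣tabulate∣ : ∀ {n} (f : Fin n → Bool) → ∣ tabulate f ∣ ≡ count f
∣tabulate∣ f = trans (∣∣-count (tabulate f)) (count-cong (lookup∘tabulate f))

∣∩∣-count : ∀ {n} (x y : Subset n) → ∣ x ∩ y ∣ ≡ count (λ q → lookup x q ∧ lookup y q)
∣∩∣-count x y = trans (∣∣-count (x ∩ y)) (count-cong (λ q → lookup-zipWith _∧_ q x y))

∣∣-remove : ∀ {n} (x : Subset n) p → ∣ x ∣ ≡ bit (lookup x p) + count (λ q → q ≢ᵇ p ∧ lookup x q)
∣∣-remove x p = trans (∣∣-count x) (count-remove (lookup x) p)

∣∣-remove-∈ : ∀ {n} (x : Subset n) {p} → lookup x p ≡ true →
              ∣ x ∣ ≡ suc (count (λ q → q ≢ᵇ p ∧ lookup x q))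
∣∣-remove-∈ x {p} x∋p =
  trans (∣∣-remove x p) (cong (λ b → bit b + count (λ q → q ≢ᵇ p ∧ lookup x q)) x∋p)

lookup-⊕ : ∀ {n} (x y : Word n) i → lookup (x ⊕ y) i ≡ lookup x i xor lookup y i
lookup-⊕ x y i = lookup-zipWith _xor_ i x y

lookup-∅ : ∀ {n} (i : Fin n) → lookup (∅ {n}) i ≡ false
lookup-∅ i = lookup-replicate i false

lookup-full : ∀ {n} (i : Fin n) → lookup (full {n}) i ≡ true
lookup-full i = lookup-replicate i true

∅-⊕ : ∀ {n} (x : Word n) → ∅ ⊕ x ≡ x
∅-⊕ x = zipWith-identityˡ (λ _ → refl) x

⊕-∅ : ∀ {n} (x : Word n) → x ⊕ ∅ ≡ x
⊕-∅ x = zipWith-identityʳ xor-identityʳ x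

⊕≡∅⇒≡ : ∀ {n} {x y : Word n} → x ⊕ y ≡ ∅ → x ≡ y
⊕≡∅⇒≡ {x = x} {y} x⊕y≡∅ = lookup-ext λ i → xor≡false⇒≡ (trans (sym (lookup-⊕ x y i))
  (trans (cong (λ z → lookup z i) x⊕y≡∅) (lookup-∅ i)))

⊕-swap : ∀ {n} {x e x′ e′ : Word n} → x ⊕ e ≡ x′ ⊕ e′ → x ⊕ x′ ≡ e ⊕ e′
⊕-swap {x = x} {e} {x′} {e′} eq = lookup-ext λ i →
  trans (lookup-⊕ x x′ i) (trans (xor-swap {lookup x i} {lookup e i} {lookup x′ i} {lookup e′ i} same-i)
                                 (sym (lookup-⊕ e e′ i)))
  where
  same-i : ∀ {i} → lookup x i xor lookup e i ≡ lookup x′ i xor lookup e′ i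
  same-i {i} = trans (sym (lookup-⊕ x e i)) (trans (cong (λ w → lookup w i) eq) (lookup-⊕ x′ e′ i))

_≟ʷ_ : ∀ {n} (x y : Word n) → Dec (x ≡ y)
_≟ʷ_ = ≡-dec Bool._≟_

≢∅⇒∃true : ∀ {n} {x : Word n} → x ≢ ∅ → ∃ λ p → lookup x p ≡ true
≢∅⇒∃true {x = x} x≢∅ with some-true-or-all-false (lookup x)
... | inj₁ some     = some
... | inj₂ all-false = contradiction (lookup-ext λ q → trans (all-false q) (sym (lookup-∅ q))) x≢∅

≢∅⇒1≤∣∣ : ∀ {n} {x : Word n} → x ≢ ∅ → 1 ≤ ∣ x ∣
≢∅⇒1≤∣∣ {x = x} x≢∅ with ≢∅⇒∃true x≢∅
... | p , x∋p = ≤-trans (s≤s z≤n) (≤-reflexive (sym (∣∣-remove-∈ x x∋p)))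

1≤∣∣⇒≢∅ : ∀ {n} {x : Word n} → 1 ≤ ∣ x ∣ → x ≢ ∅
1≤∣∣⇒≢∅ {n} 1≤∣∅∣ refl = <⇒≢ 1≤∣∅∣ (sym (∣⊥∣≡0 n))

tail-⊕ : ∀ {N} (x y : Word (suc N)) → tail (x ⊕ y) ≡ tail x ⊕ tail y
tail-⊕ (_ ∷ _) (_ ∷ _) = refl

∣∣≤1+∣tail∣ : ∀ {N} (x : Word (suc N)) → ∣ x ∣ ≤ 1 + ∣ tail x ∣
∣∣≤1+∣tail∣ (true  ∷ x) = ≤-refl
∣∣≤1+∣tail∣ (false ∷ x) = n≤1+n _

∣⊕∣≤ : ∀ {n} (x y : Word n) → ∣ x ⊕ y ∣ ≤ ∣ x ∣ + ∣ y ∣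
∣⊕∣≤ []          []          = z≤n
∣⊕∣≤ (true ∷ x)  (true ∷ y)  =
  ≤-trans (∣⊕∣≤ x y) (≤-trans (+-monoʳ-≤ ∣ x ∣ (n≤1+n _)) (n≤1+n _))
∣⊕∣≤ (true ∷ x)  (false ∷ y) = s≤s (∣⊕∣≤ x y)
∣⊕∣≤ (false ∷ x) (true ∷ y)  =
  ≤-trans (s≤s (∣⊕∣≤ x y)) (≤-reflexive (sym (+-suc ∣ x ∣ ∣ y ∣)))
∣⊕∣≤ (false ∷ x) (false ∷ y) = ∣⊕∣≤ x y

∣⊕∣≤1+∣tail∣+∣tail∣ : ∀ {N} (x y : Word (suc N)) → ∣ x ⊕ y ∣ ≤ 1 + (∣ tail x ∣ + ∣ tail y ∣)
∣⊕∣≤1+∣tail∣+∣tail∣ x y = ≤-trans (∣∣≤1+∣tail∣ (x ⊕ y))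
  (s≤s (≤-trans (≤-reflexive (cong ∣_∣ (tail-⊕ x y))) (∣⊕∣≤ (tail x) (tail y))))

parity≡odd∣∣ : ∀ {n} (x : Subset n) → parity x ≡ odd ∣ x ∣
parity≡odd∣∣ []          = refl
parity≡odd∣∣ (true ∷ x)  = cong not (parity≡odd∣∣ x)
parity≡odd∣∣ (false ∷ x) = parity≡odd∣∣ x

dot≡odd∣∩∣ : ∀ {n} (x y : Word n) → dot x y ≡ odd ∣ x ∩ y ∣
dot≡odd∣∩∣ x y = parity≡odd∣∣ (x ∩ y)

dot-count : ∀ {n} (x y : Word n) → dot x y ≡ odd (count (λ q → lookup x q ∧ lookup y q))
dot-count x y = trans (dot≡odd∣∩∣ x y) (cong odd (∣∩∣-count x y))

dot-fullʳ : ∀ {n} (x : Word n) → dot x full ≡ odd ∣ x ∣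
dot-fullʳ x = trans (cong parity (zipWith-identityʳ ∧-identityʳ x)) (parity≡odd∣∣ x)

dot-⊕ˡ : ∀ {n} (x y z : Word n) → dot (x ⊕ y) z ≡ dot x z xor dot y z
dot-⊕ˡ x y z = begin
  dot (x ⊕ y) z
    ≡⟨ dot-count (x ⊕ y) z ⟩
  odd (count (λ q → lookup (x ⊕ y) q ∧ lookup z q))
    ≡⟨ cong odd (count-cong λ q → trans (cong (_∧ lookup z q) (lookup-⊕ x y q))
                                        (∧-distribʳ-xor (lookup z q) (lookup x q) (lookup y q))) ⟩
  odd (count (λ q → (lookup x q ∧ lookup z q) xor (lookup y q ∧ lookup z q)))
    ≡⟨ odd-count-xor (λ q → lookup x q ∧ lookup z q) (λ q → lookup y q ∧ lookup z q) ⟩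
  odd (count (λ q → lookup x q ∧ lookup z q)) xor odd (count (λ q → lookup y q ∧ lookup z q))
    ≡⟨ sym (cong₂ _xor_ (dot-count x z) (dot-count y z)) ⟩
  dot x z xor dot y z ∎
  where open ≡-Reasoning

dot-comm : ∀ {n} (x y : Word n) → dot x y ≡ dot y x
dot-comm [] [] = refl
dot-comm (a ∷ x) (b ∷ y) = cong₂ _xor_ (∧-comm a b) (dot-comm x y)

dot-⊕ʳ : ∀ {n} (x y z : Word n) → dot x (y ⊕ z) ≡ dot x y xor dot x z
dot-⊕ʳ x y z = trans (dot-comm x (y ⊕ z))
  (trans (dot-⊕ˡ y z x) (cong₂ _xor_ (dot-comm y x) (dot-comm z x)))

dot-∅ʳ : ∀ {n} (x : Word n) → dot x ∅ ≡ false
dot-∅ʳ []      = refl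
dot-∅ʳ (a ∷ x) = cong₂ _xor_ (∧-zeroʳ a) (dot-∅ʳ x)


-- Spans, duals, bases and minimum distance

lookup-lincomb : ∀ {n b} (rows : Fin b → Word n) (c : Vec Bool b) q →
                 lookup (lincomb rows c) q ≡ odd (count (λ i → lookup c i ∧ lookup (rows i) q))
lookup-lincomb {b = zero}  rows []       q = lookup-∅ q
lookup-lincomb {b = suc b} rows (c ∷ cs) q = begin
  lookup ((if c then rows zero else ∅) ⊕ lincomb (rows ∘ suc) cs) q
    ≡⟨ lookup-⊕ (if c then rows zero else ∅) (lincomb (rows ∘ suc) cs) q ⟩
  lookup (if c then rows zero else ∅) q xor lookup (lincomb (rows ∘ suc) cs) q
    ≡⟨ cong₂ _xor_ (lookup-if c) (lookup-lincomb (rows ∘ suc) cs q) ⟩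
  (c ∧ lookup (rows zero) q) xor odd (count (λ i → lookup cs i ∧ lookup (rows (suc i)) q))
    ≡⟨ sym (odd-bit+ (c ∧ lookup (rows zero) q) _) ⟩
  odd (count (λ i → lookup (c ∷ cs) i ∧ lookup (rows i) q)) ∎
  where
  open ≡-Reasoning
  lookup-if : ∀ c → lookup (if c then rows zero else ∅) q ≡ c ∧ lookup (rows zero) q
  lookup-if true  = refl
  lookup-if false = lookup-∅ q

lincomb-⊕ : ∀ {n b} (rows : Fin b → Word n) (c c′ : Vec Bool b) →
            lincomb rows (c ⊕ c′) ≡ lincomb rows c ⊕ lincomb rows c′
lincomb-⊕ rows c c′ = lookup-ext λ q → begin
  lookup (lincomb rows (c ⊕ c′)) q
    ≡⟨ lookup-lincomb rows (c ⊕ c′) q ⟩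
  odd (count (λ i → lookup (c ⊕ c′) i ∧ lookup (rows i) q))
    ≡⟨ cong odd (count-cong λ i → trans (cong (_∧ lookup (rows i) q) (lookup-⊕ c c′ i))
                                        (∧-distribʳ-xor (lookup (rows i) q) (lookup c i) (lookup c′ i))) ⟩
  odd (count (λ i → (lookup c i ∧ lookup (rows i) q) xor (lookup c′ i ∧ lookup (rows i) q)))
    ≡⟨ odd-count-xor (λ i → lookup c i ∧ lookup (rows i) q) (λ i → lookup c′ i ∧ lookup (rows i) q) ⟩
  odd (count (λ i → lookup c i ∧ lookup (rows i) q)) xor odd (count (λ i → lookup c′ i ∧ lookup (rows i) q))
    ≡⟨ sym (cong₂ _xor_ (lookup-lincomb rows c q) (lookup-lincomb rows c′ q)) ⟩
  lookup (lincomb rows c) q xor lookup (lincomb rows c′) q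
    ≡⟨ sym (lookup-⊕ (lincomb rows c) (lincomb rows c′) q) ⟩
  lookup (lincomb rows c ⊕ lincomb rows c′) q ∎
  where open ≡-Reasoning

lincomb-∅ : ∀ {n b} (rows : Fin b → Word n) → lincomb rows ∅ ≡ ∅
lincomb-∅ {b = zero}  rows = refl
lincomb-∅ {b = suc b} rows = trans (∅-⊕ _) (lincomb-∅ (rows ∘ suc))

lincomb-⁅⁆ : ∀ {n b} (rows : Fin b → Word n) (i : Fin b) → lincomb rows ⁅ i ⁆ ≡ rows i
lincomb-⁅⁆ rows zero    = trans (cong (rows zero ⊕_) (lincomb-∅ (rows ∘ suc))) (⊕-∅ (rows zero))
lincomb-⁅⁆ rows (suc i) = trans (∅-⊕ _) (lincomb-⁅⁆ (rows ∘ suc) i)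

dot-lincombʳ : ∀ {n b} (x : Word n) (rows : Fin b → Word n) →
               (∀ i → dot x (rows i) ≡ false) → ∀ c → dot x (lincomb rows c) ≡ false
dot-lincombʳ x rows x⊥rows []       = dot-∅ʳ x
dot-lincombʳ x rows x⊥rows (c ∷ cs) =
  trans (dot-⊕ʳ x (if c then rows zero else ∅) (lincomb (rows ∘ suc) cs))
        (cong₂ _xor_ (head-term c) (dot-lincombʳ x (rows ∘ suc) (x⊥rows ∘ suc) cs))
  where
  head-term : ∀ c → dot x (if c then rows zero else ∅) ≡ false
  head-term true  = x⊥rows zero
  head-term false = dot-∅ʳ x

module _ {n b} (rows : Fin b → Word n) where

  ∅∈span : InSpan rows ∅
  ∅∈span = ∅ , lincomb-∅ rows

  ⊕-∈span : ∀ {x y} → InSpan rows x → InSpan rows y → InSpan rows (x ⊕ y)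
  ⊕-∈span (c , refl) (c′ , refl) = c ⊕ c′ , lincomb-⊕ rows c c′

  row∈span : ∀ i → InSpan rows (rows i)
  row∈span i = ⁅ i ⁆ , lincomb-⁅⁆ rows i

  InSpan? : ∀ x → Dec (InSpan rows x)
  InSpan? x = anySubset? (λ c → lincomb rows c ≟ʷ x)

  ⊥rows⇒dual : ∀ x → (∀ i → dot x (rows i) ≡ false) → InDual (InSpan rows) x
  ⊥rows⇒dual x x⊥rows y (c , refl) = dot-lincombʳ x rows x⊥rows c

  dual⇒⊥rows : ∀ x → InDual (InSpan rows) x → ∀ i → dot x (rows i) ≡ false
  dual⇒⊥rows x x∈dual i = x∈dual (rows i) (row∈span i)

  InDual? : ∀ x → Dec (InDual (InSpan rows) x)
  InDual? x with all? (λ i → dot x (rows i) Bool.≟ false)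
  ... | yes x⊥rows = yes (⊥rows⇒dual x x⊥rows)
  ... | no  ¬x⊥rows = no (¬x⊥rows ∘ dual⇒⊥rows x)

lincomb-∈span : ∀ {n b k} (B : Fin k → Word n) (rows : Fin b → Word n) →
                (∀ j → InSpan B (rows j)) → ∀ c → InSpan B (lincomb rows c)
lincomb-∈span B rows rows⊆B []       = ∅∈span B
lincomb-∈span B rows rows⊆B (c ∷ cs) =
  ⊕-∈span B (head-term c) (lincomb-∈span B (rows ∘ suc) (rows⊆B ∘ suc) cs)
  where
  head-term : ∀ c → InSpan B (if c then rows zero else ∅)
  head-term true  = rows⊆B zero
  head-term false = ∅∈span B

span-suc⊆span : ∀ {n b x} (rows : Fin (suc b) → Word n) → InSpan (rows ∘ suc) x → InSpan rows x
span-suc⊆span rows (c , refl) = false ∷ c , ∅-⊕ _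

record RowBasis {n b} (rows : Fin b → Word n) : Set where
  field
    rank        : ℕ
    basis       : Fin rank → Word n
    basis∈span  : ∀ i → InSpan rows (basis i)
    independent : ∀ c → lincomb basis c ≡ ∅ → c ≡ ∅
    rows∈span   : ∀ j → InSpan basis (rows j)

  isDim : IsDim (InSpan rows) rank
  isDim = basis , basis∈span , independent ,
          λ { x (c , refl) → lincomb-∈span basis rows rows∈span c }

rowBasis : ∀ {n b} (rows : Fin b → Word n) → RowBasis rows
rowBasis {b = zero} rows = record
  { rank = 0 ; basis = λ () ; basis∈span = λ () ; independent = λ { [] _ → refl } ; rows∈span = λ () }
rowBasis {b = suc b} rows with rowBasis (rows ∘ suc)
... | B with InSpan? (RowBasis.basis B) (rows zero)
...   | yes row₀∈span = record
  { rank        = rank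
  ; basis       = basis
  ; basis∈span  = span-suc⊆span rows ∘ basis∈span
  ; independent = independent
  ; rows∈span   = λ { zero → row₀∈span ; (suc j) → rows∈span j } }
  where open RowBasis B
...   | no row₀∉span = record
  { rank        = suc rank
  ; basis       = basis′
  ; basis∈span  = λ { zero → row∈span rows zero ; (suc i) → span-suc⊆span rows (basis∈span i) }
  ; independent = independent′
  ; rows∈span   = λ { zero → row∈span basis′ zero ; (suc j) → span-suc⊆span basis′ (rows∈span j) } }
  where
  open RowBasis B
  basis′ : Fin (suc rank) → Word _
  basis′ zero    = rows zero
  basis′ (suc i) = basis i
  independent′ : ∀ c → lincomb basis′ c ≡ ∅ → c ≡ ∅
  independent′ (false ∷ c) ≡∅ = cong (false ∷_) (independent c (trans (sym (∅-⊕ _)) ≡∅))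
  independent′ (true ∷ c)  ≡∅ = contradiction (c , sym (⊕≡∅⇒≡ ≡∅)) row₀∉span

module _ {n} {P : Word n → Set} (P? : ∀ x → Dec (P x)) where

  minimum-weight-below : ∀ w x → P x → ∣ x ∣ ≤ w → ∃ λ y → P y × (∀ z → P z → ∣ y ∣ ≤ ∣ z ∣)
  minimum-weight-below w x px ∣x∣≤w with anySubset? (λ z → P? z ×-dec (∣ z ∣ <? ∣ x ∣))
  ... | no none = x , px , λ z pz → ≮⇒≥ (λ ∣z∣<∣x∣ → none (z , pz , ∣z∣<∣x∣))
  minimum-weight-below zero    x px ∣x∣≤0   | yes (z , _ , ∣z∣<∣x∣) =
    contradiction (≤-trans ∣z∣<∣x∣ ∣x∣≤0) λ ()
  minimum-weight-below (suc w) x px ∣x∣≤1+w | yes (z , pz , ∣z∣<∣x∣) =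
    minimum-weight-below w z pz (≤-pred (≤-trans ∣z∣<∣x∣ ∣x∣≤1+w))

minDist-exists : ∀ {n} {P : Word n → Set} → (∀ x → Dec (P x)) →
                 ∀ {x} → P x → x ≢ ∅ → ∃ (MinDist P)
minDist-exists P? {x} px x≢∅
  with minimum-weight-below (λ z → P? z ×-dec ¬? (z ≟ʷ ∅)) ∣ x ∣ x (px , x≢∅) ≤-refl
... | y , (py , y≢∅) , minimal = ∣ y ∣ , (y , py , y≢∅ , refl) , λ z pz z≢∅ → minimal z (pz , z≢∅)

minDist-pos : ∀ {n} {P : Word n → Set} {d} → MinDist P d → 1 ≤ d
minDist-pos ((_ , _ , x≢∅ , refl) , _) = ≢∅⇒1≤∣∣ x≢∅


-- Enumerating words

branch : ∀ {N} → List (Vec Bool N) → List (Vec Bool N) → List (Vec Bool (suc N))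
branch xs ys = map (true ∷_) xs ++ map (false ∷_) ys

length-branch : ∀ {N} (xs ys : List (Vec Bool N)) → length (branch xs ys) ≡ length xs + length ys
length-branch xs ys = trans (length-++ (map (true ∷_) xs))
  (cong₂ _+_ (length-map (true ∷_) xs) (length-map (false ∷_) ys))

branch-unique : ∀ {N} {xs ys : List (Vec Bool N)} → Unique xs → Unique ys → Unique (branch xs ys)
branch-unique {xs = xs} {ys} xs! ys! =
  Unique.++⁺ (Unique.map⁺ ∷-injectiveʳ xs!) (Unique.map⁺ ∷-injectiveʳ ys!) disjoint
  where
  disjoint : ∀ {v} → v ∈ map (true ∷_) xs × v ∈ map (false ∷_) ys → ⊥
  disjoint (v∈t , v∈f) with ∈-map⁻ (true ∷_) v∈t | ∈-map⁻ (false ∷_) v∈f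
  ... | _ , _ , refl | _ , _ , ()

∈-branch⁻ : ∀ {N} {xs ys : List (Vec Bool N)} b {u} →
            (b ∷ u) ∈ branch xs ys → (if b then u ∈ xs else u ∈ ys)
∈-branch⁻ {xs = xs} b bu∈ with ∈-++⁻ (map (true ∷_) xs) bu∈
∈-branch⁻ true  _ | inj₁ ∈t with ∈-map⁻ (true ∷_) ∈t
... | _ , u∈xs , refl = u∈xs
∈-branch⁻ false _ | inj₁ ∈t with ∈-map⁻ (true ∷_) ∈t
... | _ , _ , ()
∈-branch⁻ true  _ | inj₂ ∈f with ∈-map⁻ (false ∷_) ∈f
... | _ , _ , ()
∈-branch⁻ false _ | inj₂ ∈f with ∈-map⁻ (false ∷_) ∈f
... | _ , u∈ys , refl = u∈ys

allWords : ∀ N → List (Vec Bool N)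
allWords zero    = [] ∷ []
allWords (suc N) = branch (allWords N) (allWords N)

allWords-unique : ∀ N → Unique (allWords N)
allWords-unique zero    = All.[] ∷ []
allWords-unique (suc N) = branch-unique (allWords-unique N) (allWords-unique N)

length-allWords : ∀ N → length (allWords N) ≡ 2 ^ N
length-allWords zero    = refl
length-allWords (suc N) = trans (length-branch (allWords N) (allWords N))
  (cong₂ _+_ (length-allWords N) (trans (length-allWords N) (sym (+-identityʳ _))))

ball : (N t : ℕ) → List (Vec Bool N)
ball zero    t       = [] ∷ []
ball (suc N) zero    = branch [] (ball N zero)
ball (suc N) (suc t) = branch (ball N t) (ball N (suc t))

ball-unique : ∀ N t → Unique (ball N t)
ball-unique zero    t       = All.[] ∷ []
ball-unique (suc N) zero    = branch-unique [] (ball-unique N zero)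
ball-unique (suc N) (suc t) = branch-unique (ball-unique N t) (ball-unique N (suc t))

∈-ball⁻ : ∀ {N t} (x : Vec Bool N) → x ∈ ball N t → ∣ x ∣ ≤ t
∈-ball⁻ {zero}              []          _    = z≤n
∈-ball⁻ {suc N} {zero}      (true ∷ x)  x∈ = contradiction (∈-branch⁻ {xs = []} true x∈) λ ()
∈-ball⁻ {suc N} {zero}      (false ∷ x) x∈ = ∈-ball⁻ x (∈-branch⁻ false x∈)
∈-ball⁻ {suc N} {suc t}     (true ∷ x)  x∈ = s≤s (∈-ball⁻ x (∈-branch⁻ true x∈))
∈-ball⁻ {suc N} {suc t}     (false ∷ x) x∈ = ∈-ball⁻ x (∈-branch⁻ false x∈)

binomSum-∑ : ∀ N k → binomSum N k ≡ ∑[ i < k ] (N C toℕ i)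
binomSum-∑ N k = trans (cong sumˡ (map-upTo (N C_) k)) (applyUpTo-∑ (N C_) k)
  where
  applyUpTo-∑ : ∀ f k → sumˡ (applyUpTo f k) ≡ ∑[ i < k ] f (toℕ i)
  applyUpTo-∑ f zero    = refl
  applyUpTo-∑ f (suc k) = cong (f 0 +_) (applyUpTo-∑ (f ∘ suc) k)

length-ball : ∀ N t → length (ball N t) ≡ binomSum N (suc t)
length-ball N t = trans (length-ball-∑ N t) (sym (binomSum-∑ N (suc t)))
  where
  length-ball-∑ : ∀ N t → length (ball N t) ≡ ∑[ i < suc t ] (N C toℕ i)
  length-ball-∑ zero    t       = cong suc (sym (sum-replicate-zero t))
  length-ball-∑ (suc N) zero    = trans (length-branch [] (ball N zero)) (length-ball-∑ N zero)
  length-ball-∑ (suc N) (suc t) = begin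
    length (branch (ball N t) (ball N (suc t)))
      ≡⟨ length-branch (ball N t) (ball N (suc t)) ⟩
    length (ball N t) + length (ball N (suc t))
      ≡⟨ cong₂ _+_ (length-ball-∑ N t) (length-ball-∑ N (suc t)) ⟩
    ∑[ i < suc t ] (N C toℕ i) + (1 + ∑[ i < suc t ] (N C suc (toℕ i)))
      ≡⟨ x∙yz≈y∙xz (∑[ i < suc t ] (N C toℕ i)) 1 _ ⟩
    1 + (∑[ i < suc t ] (N C toℕ i) + ∑[ i < suc t ] (N C suc (toℕ i)))
      ≡⟨ cong suc (sym (∑-distrib-+ {suc t} (λ i → N C toℕ i) (λ i → N C suc (toℕ i)))) ⟩
    1 + ∑[ i < suc t ] (N C toℕ i + N C suc (toℕ i))
      ≡⟨ cong suc (sum-cong-≗ {suc t} (λ i → nCk+nC[k+1]≡[n+1]C[k+1] N (toℕ i))) ⟩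
    ∑[ i < suc (suc t) ] (suc N C toℕ i) ∎
    where open ≡-Reasoning

encode : ∀ {N} → Vec Bool N → Fin (2 ^ N)
encode []      = zero
encode {suc N} (b ∷ x) = combine {2} {2 ^ N} (if b then suc zero else zero) (encode x)

encode-injective : ∀ {N} {x y : Vec Bool N} → encode x ≡ encode y → x ≡ y
encode-injective {x = []}    {[]}    _  = refl
encode-injective {x = a ∷ x} {b ∷ y} eq with combine-injective _ _ _ _ eq
... | a≡b , x≡y = cong₂ _∷_ (if-injective a b a≡b) (encode-injective x≡y)
  where
  if-injective : ∀ a b → (if a then suc zero else zero) ≡ (if b then suc zero else zero) → a ≡ b
  if-injective true  true  _ = refl
  if-injective false false _ = refl
  if-injective true  false ()
  if-injective false true  ()

Unique-lookup-injective : ∀ {A : Set} {xs : List A} → Unique xs →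
                          ∀ {i j} → lookupˡ xs i ≡ lookupˡ xs j → i ≡ j
Unique-lookup-injective (_ ∷ _)    {zero}  {zero}  _  = refl
Unique-lookup-injective (x∉ ∷ _)   {zero}  {suc j} eq = contradiction eq (All.lookup x∉ (∈-lookup j))
Unique-lookup-injective (x∉ ∷ _)   {suc i} {zero}  eq = contradiction (sym eq) (All.lookup x∉ (∈-lookup i))
Unique-lookup-injective (_ ∷ xs!)  {suc i} {suc j} eq = cong suc (Unique-lookup-injective xs! eq)

length≤2^ : ∀ {A : Set} {N} (f : A → Vec Bool N) {xs : List A} → Unique xs →
            (∀ {x y} → x ∈ xs → y ∈ xs → f x ≡ f y → x ≡ y) → length xs ≤ 2 ^ N
length≤2^ f {xs} xs! f-injective = injective⇒≤ {f = encode ∘ f ∘ lookupˡ xs}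
  λ eq → Unique-lookup-injective xs! (f-injective (∈-lookup _) (∈-lookup _) (encode-injective eq))

length-cartesianProduct : ∀ {A B : Set} (xs : List A) (ys : List B) →
                          length (cartesianProduct xs ys) ≡ length xs * length ys
length-cartesianProduct []       ys = refl
length-cartesianProduct (x ∷ xs) ys = trans (length-++ (map (x ,_) ys))
  (cong₂ _+_ (length-map (x ,_) ys) (length-cartesianProduct xs ys))


-- Sphere-packing bounds on the dimension

-- Words whose tails have weight ≤ t have distinct syndromes: their sums are too light to lie in the dual.
syndrome-bound : ∀ {n b rk d⊥ t} (rows : Fin b → Word n) → 1 ≤ n →
                 IsDim (InSpan rows) rk → MinDist (InDual (InSpan rows)) d⊥ → 2 + (t + t) ≤ d⊥ →
                 2 * binomSum (n ∸ 1) (suc t) ≤ 2 ^ rk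
syndrome-bound {suc N} {rk = rk} {d⊥} {t} rows _ (basis , _ , _ , spans) (_ , d⊥≤) 2+2t≤d⊥ = begin
  2 * binomSum N (suc t)                ≡⟨ cong (2 *_) (sym (length-ball N t)) ⟩
  2 * length (ball N t)                 ≡⟨ cong (length (ball N t) +_) (+-identityʳ _) ⟩
  length (ball N t) + length (ball N t) ≡⟨ sym (length-branch (ball N t) (ball N t)) ⟩
  length W                              ≤⟨ length≤2^ syndrome (branch-unique (ball-unique N t) (ball-unique N t))
                                                     syndrome-injective ⟩
  2 ^ rk ∎
  where
  open ≤-Reasoning
  W : List (Word (suc N))
  W = branch (ball N t) (ball N t)
  syndrome : Word (suc N) → Vec Bool rk
  syndrome x = tabulate (λ i → dot x (basis i))
  ∣tail∣≤t : ∀ {w} → w ∈ W → ∣ tail w ∣ ≤ t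
  ∣tail∣≤t {true  ∷ u} w∈W = ∈-ball⁻ u (∈-branch⁻ true w∈W)
  ∣tail∣≤t {false ∷ u} w∈W = ∈-ball⁻ u (∈-branch⁻ false w∈W)
  syndrome-injective : ∀ {w w′} → w ∈ W → w′ ∈ W → syndrome w ≡ syndrome w′ → w ≡ w′
  syndrome-injective {w} {w′} w∈ w′∈ same with (w ⊕ w′) ≟ʷ ∅
  ... | yes w⊕w′≡∅ = ⊕≡∅⇒≡ w⊕w′≡∅
  ... | no  w⊕w′≢∅ = contradiction (d⊥≤ (w ⊕ w′) w⊕w′∈dual w⊕w′≢∅) (<⇒≱ (begin-strict
      ∣ w ⊕ w′ ∣                     ≤⟨ ∣⊕∣≤1+∣tail∣+∣tail∣ w w′ ⟩
      1 + (∣ tail w ∣ + ∣ tail w′ ∣) ≤⟨ s≤s (+-mono-≤ (∣tail∣≤t w∈) (∣tail∣≤t w′∈)) ⟩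
      1 + (t + t)                    <⟨ n<1+n _ ⟩
      2 + (t + t)                    ≤⟨ 2+2t≤d⊥ ⟩
      d⊥                             ∎))
    where
    w⊕w′⊥basis : ∀ i → dot (w ⊕ w′) (basis i) ≡ false
    w⊕w′⊥basis i = trans (dot-⊕ˡ w w′ (basis i))
      (trans (cong (_xor dot w′ (basis i)) (trans (sym (lookup∘tabulate _ i))
                                             (trans (cong (λ s → lookup s i) same) (lookup∘tabulate _ i))))
             (xor-same (dot w′ (basis i))))
    w⊕w′∈dual : InDual (InSpan rows) (w ⊕ w′)
    w⊕w′∈dual y y∈span with spans y y∈span
    ... | c , refl = dot-lincombʳ (w ⊕ w′) basis w⊕w′⊥basis c

-- The translates of the ball by the codewords punctured at the first coordinate are pairwise disjoint.
punctured-bound : ∀ {n b rk d u} (rows : Fin b → Word n) → 1 ≤ n →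
                  IsDim (InSpan rows) rk → MinDist (InSpan rows) d → 2 + (u + u) ≤ d →
                  2 ^ rk * binomSum (n ∸ 1) (suc u) ≤ 2 ^ (n ∸ 1)
punctured-bound {suc N} {rk = rk} {d} {u} rows _ (basis , basis∈span , independent , _) (_ , d≤) 2+2u≤d = begin
  2 ^ rk * binomSum N (suc u)                ≡⟨ cong₂ _*_ (sym (length-allWords rk)) (sym (length-ball N u)) ⟩
  length (allWords rk) * length (ball N u)   ≡⟨ sym (length-cartesianProduct (allWords rk) (ball N u)) ⟩
  length pairs                               ≤⟨ length≤2^ shifted pairs-unique shifted-injective ⟩
  2 ^ N ∎
  where
  open ≤-Reasoning
  pairs : List (Vec Bool rk × Vec Bool N)
  pairs = cartesianProduct (allWords rk) (ball N u)
  pairs-unique : Unique pairs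
  pairs-unique = Unique.cartesianProduct⁺ (allWords-unique rk) (ball-unique N u)
  shifted : Vec Bool rk × Vec Bool N → Vec Bool N
  shifted (c , e) = tail (lincomb basis c) ⊕ e
  shifted-injective : ∀ {p p′} → p ∈ pairs → p′ ∈ pairs → shifted p ≡ shifted p′ → p ≡ p′
  shifted-injective {c , e} {c′ , e′} p∈ p′∈ same
    with ∈-cartesianProduct⁻ (allWords rk) (ball N u) p∈ | ∈-cartesianProduct⁻ (allWords rk) (ball N u) p′∈
  ... | _ , e∈ | _ , e′∈ = cong₂ _,_ c≡c′ (⊕≡∅⇒≡ (trans (sym tail-x) (cong tail x≡∅)))
    where
    x : Word (suc N)
    x = lincomb basis (c ⊕ c′)
    tail-x : tail x ≡ e ⊕ e′
    tail-x = trans (cong tail (lincomb-⊕ basis c c′))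
               (trans (tail-⊕ (lincomb basis c) (lincomb basis c′)) (⊕-swap same))
    x≡∅ : x ≡ ∅
    x≡∅ with x ≟ʷ ∅
    ... | yes x≡∅ = x≡∅
    ... | no  x≢∅ = contradiction (d≤ x (lincomb-∈span rows basis basis∈span (c ⊕ c′)) x≢∅)
                                  (<⇒≱ (begin-strict
      ∣ x ∣              ≤⟨ ∣∣≤1+∣tail∣ x ⟩
      1 + ∣ tail x ∣     ≡⟨ cong (λ y → 1 + ∣ y ∣) tail-x ⟩
      1 + ∣ e ⊕ e′ ∣     ≤⟨ s≤s (∣⊕∣≤ e e′) ⟩
      1 + (∣ e ∣ + ∣ e′ ∣) ≤⟨ s≤s (+-mono-≤ (∈-ball⁻ e e∈) (∈-ball⁻ e′ e′∈)) ⟩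
      1 + (u + u)        <⟨ n<1+n _ ⟩
      2 + (u + u)        ≤⟨ 2+2u≤d ⟩
      d                  ∎))
    c≡c′ : c ≡ c′
    c≡c′ = ⊕≡∅⇒≡ (independent (c ⊕ c′) x≡∅)

1+⌈log₂⌉≤ : ∀ {S r} → 1 ≤ S → 2 * S ≤ 2 ^ r → 1 + ⌈log₂ S ⌉ ≤ r
1+⌈log₂⌉≤ {suc S} {r} _ 2S≤2^r = begin
  1 + ⌈log₂ (suc S) ⌉ ≡⟨ sym (⌈log₂2*n⌉≡1+⌈log₂n⌉ (suc S)) ⟩
  ⌈log₂ (2 * suc S) ⌉ ≤⟨ ⌈log₂⌉-mono-≤ 2S≤2^r ⟩
  ⌈log₂ (2 ^ r) ⌉     ≡⟨ ⌈log₂2^n⌉≡n r ⟩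
  r                   ∎
  where open ≤-Reasoning

⌊log₂2^r*⌋ : ∀ r S → ⌊log₂ (2 ^ r * suc S) ⌋ ≡ r + ⌊log₂ (suc S) ⌋
⌊log₂2^r*⌋ zero    S = cong ⌊log₂_⌋ (+-identityʳ (suc S))
⌊log₂2^r*⌋ (suc r) S = begin
  ⌊log₂ (2 * 2 ^ r * suc S) ⌋   ≡⟨ cong ⌊log₂_⌋ (*-assoc 2 (2 ^ r) (suc S)) ⟩
  ⌊log₂ (2 * (2 ^ r * suc S)) ⌋ ≡⟨ ⌊log₂[2*b]⌋≡1+⌊log₂b⌋ (2 ^ r * suc S)
                                     {{m*n≢0 (2 ^ r) (suc S) {{m^n≢0 2 r}}}} ⟩
  1 + ⌊log₂ (2 ^ r * suc S) ⌋   ≡⟨ cong suc (⌊log₂2^r*⌋ r S) ⟩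
  suc r + ⌊log₂ (suc S) ⌋       ∎
  where open ≡-Reasoning

≤∸⌊log₂⌋ : ∀ {r S N} → 1 ≤ S → 2 ^ r * S ≤ 2 ^ N → r ≤ N ∸ ⌊log₂ S ⌋
≤∸⌊log₂⌋ {r} {suc S} {N} _ 2^rS≤2^N = m+n≤o⇒m≤o∸n r (begin
  r + ⌊log₂ (suc S) ⌋       ≡⟨ sym (⌊log₂2^r*⌋ r S) ⟩
  ⌊log₂ (2 ^ r * suc S) ⌋   ≤⟨ ⌊log₂⌋-mono-≤ 2^rS≤2^N ⟩
  ⌊log₂ (2 ^ N) ⌋           ≡⟨ ⌊log₂[2^n]⌋≡n N ⟩
  N                         ∎)
  where open ≤-Reasoning

rank-lower-bound : ∀ {n b rk d⊥} t (rows : Fin b → Word n) → 1 ≤ n →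
                   IsDim (InSpan rows) rk → MinDist (InDual (InSpan rows)) d⊥ → 2 + (t + t) ≤ d⊥ →
                   1 + ⌈log₂ binomSum (n ∸ 1) (suc t) ⌉ ≤ rk
rank-lower-bound t rows 1≤n dim d⊥-min 2+2t≤d⊥ =
  1+⌈log₂⌉≤ (s≤s z≤n) (syndrome-bound {t = t} rows 1≤n dim d⊥-min 2+2t≤d⊥)

rank-lower-bound-even : ∀ {n b rk d⊥} (rows : Fin b → Word n) → 1 ≤ n →
                        IsDim (InSpan rows) rk → MinDist (InDual (InSpan rows)) d⊥ → odd d⊥ ≡ false →
                        1 + ⌈log₂ binomSum (n ∸ 1) (suc (d⊥ / 2 ∸ 1)) ⌉ ≤ rk
rank-lower-bound-even rows 1≤n dim d⊥-min d⊥-even with even-split d⊥-even (minDist-pos d⊥-min)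
... | u , refl rewrite [2+u+u]/2 u = rank-lower-bound u rows 1≤n dim d⊥-min ≤-refl

rank-upper-bound : ∀ {n b rk d} (rows : Fin b → Word n) → 1 ≤ n →
                   IsDim (InSpan rows) rk → MinDist (InSpan rows) d → odd d ≡ false →
                   rk ≤ n ∸ 1 ∸ ⌊log₂ binomSum (n ∸ 1) (d / 2) ⌋
rank-upper-bound rows 1≤n dim d-min d-even with even-split d-even (minDist-pos d-min)
... | u , refl rewrite [2+u+u]/2 u = ≤∸⌊log₂⌋ (s≤s z≤n) (punctured-bound {u = u} rows 1≤n dim d-min ≤-refl)


-- Steiner 2-designs and their codes

majority-flips : ∀ {F S h} → F + S ≡ h + h + 1 → S < h → h + h + 1 < 2 * F
majority-flips {F} {S} {h} F+S≡2h+1 S<h = +-cancelʳ-< (S + S) (h + h + 1) (2 * F) (begin-strict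
  h + h + 1 + (S + S)     <⟨ +-monoʳ-< (h + h + 1) (<-≤-trans (+-mono-< S<h S<h) (m≤m+n (h + h) 1)) ⟩
  h + h + 1 + (h + h + 1) ≡⟨ cong₂ _+_ (sym F+S≡2h+1) (sym F+S≡2h+1) ⟩
  F + S + (F + S)         ≡⟨ rearrange F S ⟩
  2 * F + (S + S)         ∎)
  where
  open ≤-Reasoning
  rearrange : ∀ F S → F + S + (F + S) ≡ 2 * F + (S + S)
  rearrange = solve-∀

majority-stays : ∀ {F h} → F ≤ h → 2 * F ≤ h + h + 1
majority-stays {F} {h} F≤h = begin
  2 * F     ≤⟨ *-monoʳ-≤ 2 F≤h ⟩
  2 * h     ≡⟨ cong (h +_) (+-identityʳ h) ⟩
  h + h     ≤⟨ m≤m+n (h + h) 1 ⟩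
  h + h + 1 ∎
  where open ≤-Reasoning

<ᵇ-true : ∀ {m n} → m < n → (m <ᵇ n) ≡ true
<ᵇ-true m<n = Equivalence.to T-≡ (<⇒<ᵇ m<n)

<ᵇ-false : ∀ {m n} → n ≤ m → (m <ᵇ n) ≡ false
<ᵇ-false {m} {n} n≤m = ¬-not λ m<ᵇn → <⇒≱ (<ᵇ⇒< m n (Equivalence.from T-≡ m<ᵇn)) n≤m

module SteinerDesign {v k} (D : Steiner2Design v k) where

  incident : Fin (b D) → Fin v → Bool
  incident i p = lookup (block D i) p

  degree : Fin v → ℕ
  degree p = count (λ i → incident i p)

  othersOn : Fin v → Word v → Fin (b D) → ℕ
  othersOn p x i = count (λ q → q ≢ᵇ p ∧ (lookup x q ∧ incident i q))

  pair-count : ∀ {p q} → p ≢ q → count (λ i → incident i p ∧ incident i q) ≡ 1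
  pair-count {p} {q} p≢q with pair-unique D p q p≢q
  ... | i , (p∈i , q∈i) , unique = count-single _ i
    (cong₂ _∧_ ([]=⇒lookup p∈i) ([]=⇒lookup q∈i))
    (λ j p,q∈j → sym (unique (lookup⇒[]= p (block D j) (proj₁ (∧≡true p,q∈j)) ,
                              lookup⇒[]= q (block D j) (proj₂ (∧≡true p,q∈j)))))

  -- Double counting of the pairs (q, i) with q ∈ x ∖ {p} and p, q on block i.
  ∑-othersOn : ∀ p x → ∑[ i < b D ] (bit (incident i p) * othersOn p x i) ≡ count (λ q → q ≢ᵇ p ∧ lookup x q)
  ∑-othersOn p x = begin
    ∑[ i < b D ] (bit (incident i p) * othersOn p x i)
      ≡⟨ sum-cong-≗ {b D} (λ i → bit-*-count (incident i p) (λ q → q ≢ᵇ p ∧ (lookup x q ∧ incident i q)))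
       ⟩
    ∑[ i < b D ] count (λ q → incident i p ∧ (q ≢ᵇ p ∧ (lookup x q ∧ incident i q)))
      ≡⟨ ∑-comm (λ i q → bit (incident i p ∧ (q ≢ᵇ p ∧ (lookup x q ∧ incident i q)))) ⟩
    ∑[ q < v ] count (λ i → incident i p ∧ (q ≢ᵇ p ∧ (lookup x q ∧ incident i q)))
      ≡⟨ sum-cong-≗ {v} blocks-through-p-and ⟩
    count (λ q → q ≢ᵇ p ∧ lookup x q) ∎
    where
    open ≡-Reasoning
    blocks-through-p-and : ∀ q → count (λ i → incident i p ∧ (q ≢ᵇ p ∧ (lookup x q ∧ incident i q)))
                                 ≡ bit (q ≢ᵇ p ∧ lookup x q)
    blocks-through-p-and q with q ≟ p | lookup x q
    ... | yes _   | _     = count-false (λ i → ∧-zeroʳ (incident i p))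
    ... | no _    | false = count-false (λ i → ∧-zeroʳ (incident i p))
    ... | no q≢p  | true  = pair-count (q≢p ∘ sym)

  ∣∩block∣ : ∀ x p i → lookup x p ≡ true → incident i p ≡ true →
             ∣ x ∩ block D i ∣ ≡ suc (othersOn p x i)
  ∣∩block∣ x p i x∋p i∋p = trans (∣∩∣-count x (block D i))
    (trans (count-remove (λ q → lookup x q ∧ incident i q) p)
           (cong (λ b → bit b + othersOn p x i) (cong₂ _∧_ x∋p i∋p)))

  dot-block : ∀ x p i → incident i p ≡ true → dot x (block D i) ≡ lookup x p xor odd (othersOn p x i)
  dot-block x p i i∋p = begin
    dot x (block D i)
      ≡⟨ dot-count x (block D i) ⟩
    odd (count (λ q → lookup x q ∧ incident i q))
      ≡⟨ cong odd (count-remove (λ q → lookup x q ∧ incident i q) p) ⟩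
    odd (bit (lookup x p ∧ incident i p) + othersOn p x i)
      ≡⟨ odd-bit+ (lookup x p ∧ incident i p) _ ⟩
    (lookup x p ∧ incident i p) xor odd (othersOn p x i)
      ≡⟨ cong (λ b → (lookup x p ∧ b) xor odd (othersOn p x i)) i∋p ⟩
    (lookup x p ∧ true) xor odd (othersOn p x i)
      ≡⟨ cong (_xor odd (othersOn p x i)) (∧-identityʳ (lookup x p)) ⟩
    lookup x p xor odd (othersOn p x i) ∎
    where open ≡-Reasoning

  degree-equation : ∀ p → degree p * (k ∸ 1) ≡ v ∸ 1
  degree-equation p = begin
    degree p * (k ∸ 1)
      ≡⟨ *-distribʳ-sum (k ∸ 1) (λ i → bit (incident i p)) ⟩
    ∑[ i < b D ] (bit (incident i p) * (k ∸ 1))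
      ≡⟨ sum-cong-≗ {b D} othersOn-full ⟩
    ∑[ i < b D ] (bit (incident i p) * othersOn p full i)
      ≡⟨ ∑-othersOn p full ⟩
    count (λ q → q ≢ᵇ p ∧ lookup full q)
      ≡⟨ cong pred (sym (∣∣-remove-∈ full {p} (lookup-full p))) ⟩
    pred ∣ full {v} ∣
      ≡⟨ cong pred (∣⊤∣≡n v) ⟩
    v ∸ 1 ∎
    where
    open ≡-Reasoning
    othersOn-full : ∀ i → bit (incident i p) * (k ∸ 1) ≡ bit (incident i p) * othersOn p full i
    othersOn-full i with incident i p in i∋p
    ... | false = refl
    ... | true  = cong (1 *_) (cong pred (begin
      k                          ≡⟨ sym (block-size D i) ⟩
      ∣ block D i ∣              ≡⟨ sym (cong ∣_∣ (zipWith-identityˡ {e = true} ∧-identityˡ (block D i))) ⟩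
      ∣ full ∩ block D i ∣       ≡⟨ ∣∩block∣ full p i (lookup-full p) i∋p ⟩
      suc (othersOn p full i)    ∎))

  -- Checks through p that disagree with the bit x_p each contain a further point of x.
  disagreeing-checks : ∀ x p → count (λ i → incident i p ∧ (dot x (block D i) xor lookup x p))
                               ≤ count (λ q → q ≢ᵇ p ∧ lookup x q)
  disagreeing-checks x p = begin
    count (λ i → incident i p ∧ (dot x (block D i) xor lookup x p))
      ≤⟨ ∑-mono-≤ pointwise ⟩
    ∑[ i < b D ] (bit (incident i p) * othersOn p x i)
      ≡⟨ ∑-othersOn p x ⟩
    count (λ q → q ≢ᵇ p ∧ lookup x q) ∎
    where
    open ≤-Reasoning
    pointwise : ∀ i → bit (incident i p ∧ (dot x (block D i) xor lookup x p)) ≤ bit (incident i p) * othersOn p x i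
    pointwise i with incident i p in i∋p
    ... | false = z≤n
    ... | true  = begin
      bit (dot x (block D i) xor lookup x p)
        ≡⟨ cong (λ b → bit (b xor lookup x p)) (dot-block x p i i∋p) ⟩
      bit ((lookup x p xor odd (othersOn p x i)) xor lookup x p)
        ≡⟨ cong bit (xor-cancelʳ (lookup x p) _) ⟩
      bit (odd (othersOn p x i))
        ≤⟨ bit-odd≤ _ ⟩
      othersOn p x i
        ≡⟨ sym (*-identityˡ _) ⟩
      1 * othersOn p x i ∎
      where
      xor-cancelʳ : ∀ a o → (a xor o) xor a ≡ o
      xor-cancelʳ false o     = xor-identityʳ o
      xor-cancelʳ true  false = refl
      xor-cancelʳ true  true  = refl

  block∈Code : ∀ i → Code D (block D i)
  block∈Code = row∈span (block D)

  full∈Dual : odd k ≡ false → DualCode D full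
  full∈Dual k-even = ⊥rows⇒dual (block D) full λ i →
    trans (dot-comm full (block D i)) (trans (dot-fullʳ (block D i)) (trans (cong odd (block-size D i)) k-even))

  code-even : odd k ≡ false → ∀ x → Code D x → odd ∣ x ∣ ≡ false
  code-even k-even x x∈C = trans (sym (dot-fullʳ x)) (trans (dot-comm x full) (full∈Dual k-even x x∈C))

  block≢∅ : 1 ≤ k → ∀ i → block D i ≢ ∅
  block≢∅ 1≤k i = 1≤∣∣⇒≢∅ (≤-trans 1≤k (≤-reflexive (sym (block-size D i))))

  minDist-code-even : odd k ≡ false → ∀ {d} → MinDist (Code D) d → odd d ≡ false
  minDist-code-even k-even ((x , x∈C , _ , refl) , _) = code-even k-even x x∈C

  minDist-code≤k : Fin (b D) → 1 ≤ k → ∀ {d} → MinDist (Code D) d → d ≤ k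
  minDist-code≤k i 1≤k (_ , d≤) =
    ≤-trans (d≤ (block D i) (block∈Code i) (block≢∅ 1≤k i)) (≤-reflexive (block-size D i))

  ∃minDist-code : Fin (b D) → 1 ≤ k → ∃ (MinDist (Code D))
  ∃minDist-code i 1≤k = minDist-exists (InSpan? (block D)) {block D i} (block∈Code i) (block≢∅ 1≤k i)

  ∃minDist-dual : Fin v → odd k ≡ false → ∃ (MinDist (DualCode D))
  ∃minDist-dual p k-even = minDist-exists (InDual? (block D)) {full} (full∈Dual k-even)
    (1≤∣∣⇒≢∅ (≤-trans (s≤s z≤n) (≤-reflexive (sym (∣∣-remove-∈ full {p} (lookup-full p))))))

  ∃rank : ∃ (Rank2 D)
  ∃rank = RowBasis.rank (rowBasis (block D)) , RowBasis.isDim (rowBasis (block D))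

  satisfied-checks : ∀ e j → lookup e j ≡ true →
                     suc (count (λ i → incident i j ∧ not (dot e (block D i)))) ≤ ∣ e ∣
  satisfied-checks e j e∋j = begin
    suc (count (λ i → incident i j ∧ not (dot e (block D i))))
      ≡⟨ cong suc (count-cong λ i → cong (incident i j ∧_)
           (sym (trans (cong (dot e (block D i) xor_) e∋j) (xor-comm (dot e (block D i)) true)))) ⟩
    suc (count (λ i → incident i j ∧ (dot e (block D i) xor lookup e j)))
      ≤⟨ s≤s (disagreeing-checks e j) ⟩
    suc (count (λ q → q ≢ᵇ j ∧ lookup e q))
      ≡⟨ sym (∣∣-remove-∈ e e∋j) ⟩
    ∣ e ∣ ∎
    where open ≤-Reasoning

  failed-checks : ∀ e j → lookup e j ≡ false → count (λ i → incident i j ∧ dot e (block D i)) ≤ ∣ e ∣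
  failed-checks e j e∌j = begin
    count (λ i → incident i j ∧ dot e (block D i))
      ≡⟨ count-cong (λ i → cong (incident i j ∧_)
           (sym (trans (cong (dot e (block D i) xor_) e∌j) (xor-identityʳ (dot e (block D i)))))) ⟩
    count (λ i → incident i j ∧ (dot e (block D i) xor lookup e j))
      ≤⟨ disagreeing-checks e j ⟩
    count (λ q → q ≢ᵇ j ∧ lookup e q)
      ≡⟨ sym (trans (∣∣-remove e j) (cong (λ b → bit b + count (λ q → q ≢ᵇ j ∧ lookup e q)) e∌j)) ⟩
    ∣ e ∣ ∎
    where open ≤-Reasoning

  meets-or-misses : ∀ x i → (∃ λ p → lookup x p ≡ true × incident i p ≡ true) ⊎ ∣ x ∩ block D i ∣ ≡ 0
  meets-or-misses x i with some-true-or-all-false (λ q → lookup x q ∧ incident i q)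
  ... | inj₁ (p , x∧i∋p) = inj₁ (p , ∧≡true x∧i∋p)
  ... | inj₂ none        = inj₂ (trans (∣∩∣-count x (block D i)) (count-false none))

  module ConstantDegree (r : ℕ) (degree≡r : ∀ p → degree p ≡ r) where

    full∈Code : Fin v → odd r ≡ true → Code D full
    full∈Code p r-odd = tabulate (λ i → incident i p) , lookup-ext λ q → begin
      lookup (lincomb (block D) (tabulate (λ i → incident i p))) q
        ≡⟨ lookup-lincomb (block D) _ q ⟩
      odd (count (λ i → lookup (tabulate (λ i → incident i p)) i ∧ incident i q))
        ≡⟨ cong odd (count-cong λ i → cong (_∧ incident i q) (lookup∘tabulate (λ i → incident i p) i)) ⟩
      odd (count (λ i → incident i p ∧ incident i q))
        ≡⟨ blocks-through-p-and q ⟩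
      true
        ≡⟨ sym (lookup-full q) ⟩
      lookup full q ∎
      where
      open ≡-Reasoning
      blocks-through-p-and : ∀ q → odd (count (λ i → incident i p ∧ incident i q)) ≡ true
      blocks-through-p-and q with q ≟ p
      ... | yes refl = trans (cong odd (trans (count-cong (λ i → ∧-idem (incident i q))) (degree≡r q))) r-odd
      ... | no q≢p   = cong odd (pair-count (q≢p ∘ sym))

    dual-even : Fin v → odd r ≡ true → ∀ x → DualCode D x → odd ∣ x ∣ ≡ false
    dual-even p r-odd x x∈C⊥ = trans (sym (dot-fullʳ x)) (x∈C⊥ full (full∈Code p r-odd))

    -- Every block through a point p of a dual codeword meets it again.
    dual-weight≥ : ∀ x → DualCode D x → x ≢ ∅ → suc r ≤ ∣ x ∣
    dual-weight≥ x x∈C⊥ x≢∅ with ≢∅⇒∃true x≢∅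
    ... | p , x∋p = begin
      suc r
        ≡⟨ cong suc (sym (degree≡r p)) ⟩
      suc (count (λ i → incident i p))
        ≡⟨ cong suc (count-cong every-check-disagrees) ⟩
      suc (count (λ i → incident i p ∧ (dot x (block D i) xor lookup x p)))
        ≤⟨ s≤s (disagreeing-checks x p) ⟩
      suc (count (λ q → q ≢ᵇ p ∧ lookup x q))
        ≡⟨ sym (∣∣-remove-∈ x x∋p) ⟩
      ∣ x ∣ ∎
      where
      open ≤-Reasoning
      every-check-disagrees : ∀ i → incident i p ≡ incident i p ∧ (dot x (block D i) xor lookup x p)
      every-check-disagrees i =
        sym (trans (cong₂ (λ a b → incident i p ∧ (a xor b)) (dual⇒⊥rows (block D) x x∈C⊥ i) x∋p)
                   (∧-identityʳ (incident i p)))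

    majority-decoding : ∀ {h c e} → r ≡ h + h + 1 → DualCode D c → ∣ e ∣ ≤ h →
                        majorityDecode D (c ⊕ e) ≡ c
    majority-decoding {h} {c} {e} r≡2h+1 c∈C⊥ ∣e∣≤h = lookup-ext λ j → begin
      lookup (majorityDecode D (c ⊕ e)) j
        ≡⟨ lookup∘tabulate _ j ⟩
      lookup (c ⊕ e) j xor (numChecks D j <ᵇ 2 * numFailed D (c ⊕ e) j)
        ≡⟨ cong₂ _xor_ (lookup-⊕ c e j) (majority-vote j) ⟩
      (lookup c j xor lookup e j) xor lookup e j
        ≡⟨ xor-assoc (lookup c j) (lookup e j) (lookup e j) ⟩
      lookup c j xor (lookup e j xor lookup e j)
        ≡⟨ cong (lookup c j xor_) (xor-same (lookup e j)) ⟩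
      lookup c j xor false
        ≡⟨ xor-identityʳ (lookup c j) ⟩
      lookup c j ∎
      where
      open ≡-Reasoning
      failed : Fin v → ℕ
      failed j = count (λ i → incident i j ∧ dot e (block D i))
      numChecks≡r : ∀ j → numChecks D j ≡ r
      numChecks≡r j = trans (∣tabulate∣ (λ i → incident i j)) (degree≡r j)
      numFailed≡failed : ∀ j → numFailed D (c ⊕ e) j ≡ failed j
      numFailed≡failed j = trans (∣tabulate∣ (λ i → incident i j ∧ dot (c ⊕ e) (block D i)))
        (count-cong λ i → cong (incident i j ∧_)
          (trans (dot-⊕ˡ c e (block D i)) (cong (_xor dot e (block D i)) (dual⇒⊥rows (block D) c c∈C⊥ i))))
      majority-vote : ∀ j → (numChecks D j <ᵇ 2 * numFailed D (c ⊕ e) j) ≡ lookup e j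
      majority-vote j rewrite numChecks≡r j | numFailed≡failed j with lookup e j in e∋j
      ... | true  = <ᵇ-true (subst (_< 2 * failed j) (sym r≡2h+1) (majority-flips
                      (trans (count-∧-split (λ i → incident i j) (λ i → dot e (block D i)))
                             (trans (degree≡r j) r≡2h+1))
                      (≤-trans (satisfied-checks e j e∋j) ∣e∣≤h)))
      ... | false = <ᵇ-false (subst (2 * failed j ≤_) (sym r≡2h+1)
                      (majority-stays (≤-trans (failed-checks e j e∋j) ∣e∣≤h)))

    ∑-othersOn≡∑1 : ∀ x p → lookup x p ≡ true → ∣ x ∣ ≡ suc r →
                    ∑[ i < b D ] (bit (incident i p) * othersOn p x i) ≡ ∑[ i < b D ] (bit (incident i p) * 1)
    ∑-othersOn≡∑1 x p x∋p ∣x∣≡1+r = begin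
      ∑[ i < b D ] (bit (incident i p) * othersOn p x i)
        ≡⟨ ∑-othersOn p x ⟩
      count (λ q → q ≢ᵇ p ∧ lookup x q)
        ≡⟨ suc-injective (trans (sym (∣∣-remove-∈ x x∋p)) ∣x∣≡1+r) ⟩
      r
        ≡⟨ sym (degree≡r p) ⟩
      degree p
        ≡⟨ sum-cong-≗ {b D} (λ i → sym (*-identityʳ (bit (incident i p)))) ⟩
      ∑[ i < b D ] (bit (incident i p) * 1) ∎
      where open ≡-Reasoning

    hyperoval⇒dual : ∀ H → Hyperoval D r H → DualCode D H
    hyperoval⇒dual H (oval , ∣H∣≡1+r) =
      ⊥rows⇒dual (block D) H λ i → [ meets i , misses i ]′ (meets-or-misses H i)
      where
      misses : ∀ i → ∣ H ∩ block D i ∣ ≡ 0 → dot H (block D i) ≡ false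
      misses i ∣H∩i∣≡0 = trans (dot≡odd∣∩∣ H (block D i)) (cong odd ∣H∩i∣≡0)
      meets : ∀ i → (∃ λ p → lookup H p ≡ true × incident i p ≡ true) → dot H (block D i) ≡ false
      meets i (p , H∋p , i∋p) = trans (dot-block H p i i∋p) (cong₂ _xor_ H∋p (cong odd (
        ∑-guarded-≤-≡⇒≡ (λ j → incident j p) at-most-one (∑-othersOn≡∑1 H p H∋p ∣H∣≡1+r) i i∋p)))
        where
        at-most-one : ∀ j → incident j p ≡ true → othersOn p H j ≤ 1
        at-most-one j j∋p = ≤-pred (subst (_≤ 2) (∣∩block∣ H p j H∋p j∋p) (oval j))

    minimal-dual⇒hyperoval : ∀ x → DualCode D x → ∣ x ∣ ≡ suc r → Hyperoval D r x
    minimal-dual⇒hyperoval x x∈C⊥ ∣x∣≡1+r =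
      (λ i → [ meets i , misses i ]′ (meets-or-misses x i)) , ∣x∣≡1+r
      where
      misses : ∀ i → ∣ x ∩ block D i ∣ ≡ 0 → ∣ x ∩ block D i ∣ ≤ 2
      misses i ∣x∩i∣≡0 = ≤-trans (≤-reflexive ∣x∩i∣≡0) z≤n
      meets : ∀ i → (∃ λ p → lookup x p ≡ true × incident i p ≡ true) → ∣ x ∩ block D i ∣ ≤ 2
      meets i (p , x∋p , i∋p) = ≤-reflexive (trans (∣∩block∣ x p i x∋p i∋p) (cong suc (sym (
        ∑-guarded-≤-≡⇒≡ (λ j → incident j p) at-least-one
                        (sym (∑-othersOn≡∑1 x p x∋p ∣x∣≡1+r)) i i∋p))))
        where
        at-least-one : ∀ j → incident j p ≡ true → 1 ≤ othersOn p x j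
        at-least-one j j∋p = odd≡true⇒≥1 (trans (sym (not-involutive _)) (cong not (begin
          not (odd (othersOn p x j))            ≡⟨⟩
          true xor odd (othersOn p x j)         ≡⟨ cong (_xor odd (othersOn p x j)) (sym x∋p) ⟩
          lookup x p xor odd (othersOn p x j)   ≡⟨ sym (dot-block x p j j∋p) ⟩
          dot x (block D j)                     ≡⟨ dual⇒⊥rows (block D) x x∈C⊥ j ⟩
          false                                 ∎)))
          where open ≡-Reasoning

    minDist-dual-≥ : ∀ {d⊥} → MinDist (DualCode D) d⊥ → suc r ≤ d⊥
    minDist-dual-≥ ((x , x∈C⊥ , x≢∅ , refl) , _) = dual-weight≥ x x∈C⊥ x≢∅

    minDist-dual-even : Fin v → odd r ≡ true → ∀ {d⊥} → MinDist (DualCode D) d⊥ → odd d⊥ ≡ false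
    minDist-dual-even p r-odd ((x , x∈C⊥ , _ , refl) , _) = dual-even p r-odd x x∈C⊥

    minDist-dual-hyperoval : ∀ {d⊥} → MinDist (DualCode D) d⊥ → HasHyperoval D r → d⊥ ≡ suc r
    minDist-dual-hyperoval d⊥-min@(_ , d⊥≤) (H , H-hyp@(_ , ∣H∣≡1+r)) = ≤-antisym
      (≤-trans (d⊥≤ H (hyperoval⇒dual H H-hyp) (1≤∣∣⇒≢∅ (≤-trans (s≤s z≤n) (≤-reflexive (sym ∣H∣≡1+r)))))
               (≤-reflexive ∣H∣≡1+r))
      (minDist-dual-≥ d⊥-min)

    minDist-dual-no-hyperoval : Fin v → odd r ≡ true → ∀ {d⊥} → MinDist (DualCode D) d⊥ →
                                ¬ HasHyperoval D r → 3 + r ≤ d⊥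
    minDist-dual-no-hyperoval p r-odd d⊥-min@((x , x∈C⊥ , _ , refl) , _) no-hyperoval =
      even-gap (cong not r-odd) (dual-even p r-odd x x∈C⊥) (minDist-dual-≥ d⊥-min)
        (λ 1+r≡∣x∣ → no-hyperoval (x , minimal-dual⇒hyperoval x x∈C⊥ (sym 1+r≡∣x∣)))


-- The designs with 2^(m+s) − 2^m + 2^s points and blocks of size 2^s

2^≡half+half : ∀ m → 1 ≤ m → 2 ^ m ≡ 2 ^ (m ∸ 1) + 2 ^ (m ∸ 1)
2^≡half+half (suc m) _ = cong (2 ^ m +_) (+-identityʳ (2 ^ m))

odd-2^ : ∀ m → 1 ≤ m → odd (2 ^ m) ≡ false
odd-2^ m 1≤m = trans (cong odd (2^≡half+half m 1≤m)) (odd-double (2 ^ (m ∸ 1)))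

steinerLength∸1 : ∀ m s → steinerLength m s ∸ 1 ≡ (2 ^ m + 1) * (2 ^ s ∸ 1)
steinerLength∸1 m s = begin
  2 ^ (m + s) ∸ 2 ^ m + 2 ^ s ∸ 1    ≡⟨ cong (λ x → x ∸ 2 ^ m + 2 ^ s ∸ 1) (^-distribˡ-+-* 2 m s) ⟩
  2 ^ m * 2 ^ s ∸ 2 ^ m + 2 ^ s ∸ 1  ≡⟨ identity (2 ^ m) (2 ^ s) (m^n>0 2 s) ⟩
  (2 ^ m + 1) * (2 ^ s ∸ 1)          ∎
  where
  open ≡-Reasoning
  M*K+K : ∀ M K → M * K + K ≡ (M + 1) * K
  M*K+K = solve-∀
  identity : ∀ M K → 0 < K → M * K ∸ M + K ∸ 1 ≡ (M + 1) * (K ∸ 1)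
  identity M (suc K) _ = begin
    M * suc K ∸ M + suc K ∸ 1  ≡⟨ cong (λ x → x ∸ M + suc K ∸ 1) (*-suc M K) ⟩
    M + M * K ∸ M + suc K ∸ 1  ≡⟨ cong (λ x → x + suc K ∸ 1) (m+n∸m≡n M (M * K)) ⟩
    M * K + suc K ∸ 1          ≡⟨ cong (_∸ 1) (+-suc (M * K) K) ⟩
    M * K + K                  ≡⟨ M*K+K M K ⟩
    (M + 1) * K                ∎

module SteinerLengthDesign (m s : ℕ) (1≤s : 1 ≤ s) (s≤m : s ≤ m)
                           (D : Steiner2Design (steinerLength m s) (2 ^ s)) where

  open SteinerDesign D public

  1≤n : 1 ≤ steinerLength m s
  1≤n = ≤-trans (m^n>0 2 s) (m≤n+m (2 ^ s) (2 ^ (m + s) ∸ 2 ^ m))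

  p₀ : Fin (steinerLength m s)
  p₀ = fromℕ< 1≤n

  1≤k : 1 ≤ 2 ^ s
  1≤k = m^n>0 2 s

  k-even : odd (2 ^ s) ≡ false
  k-even = odd-2^ s 1≤s

  degree≡2^m+1 : ∀ p → degree p ≡ 2 ^ m + 1
  degree≡2^m+1 p = *-cancelʳ-≡ (degree p) (2 ^ m + 1) (2 ^ s ∸ 1) {{k-1≢0}}
    (trans (degree-equation p) (steinerLength∸1 m s))
    where
    k-1≢0 : NonZero (2 ^ s ∸ 1)
    k-1≢0 = >-nonZero (m<n⇒0<n∸m (^-monoʳ-≤ 2 1≤s))

  open ConstantDegree (2 ^ m + 1) degree≡2^m+1 public

  r-odd : odd (2 ^ m + 1) ≡ true
  r-odd = trans (odd-+ (2 ^ m) 1) (cong (_xor true) (odd-2^ m (≤-trans 1≤s s≤m)))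

  r≡h+h+1 : 2 ^ m + 1 ≡ 2 ^ (m ∸ 1) + 2 ^ (m ∸ 1) + 1
  r≡h+h+1 = cong (_+ 1) (2^≡half+half m (≤-trans 1≤s s≤m))

  i₀ : Fin (b D)
  i₀ = proj₁ (1≤count⇒∃ {f = λ i → incident i p₀}
                 (≤-trans (m≤n+m 1 (2 ^ m)) (≤-reflexive (sym (degree≡2^m+1 p₀)))))

  d⊥ : ℕ
  d⊥ = proj₁ (∃minDist-dual p₀ k-even)

  d⊥-min : MinDist (DualCode D) d⊥
  d⊥-min = proj₂ (∃minDist-dual p₀ k-even)

  d⊥-even : odd d⊥ ≡ false
  d⊥-even = minDist-dual-even p₀ r-odd d⊥-min

  d : ℕ
  d = proj₁ (∃minDist-code i₀ 1≤k)

  d-min : MinDist (Code D) d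
  d-min = proj₂ (∃minDist-code i₀ 1≤k)

  d-even : odd d ≡ false
  d-even = minDist-code-even k-even d-min

  rk : ℕ
  rk = proj₁ ∃rank

  rk-dim : Rank2 D rk
  rk-dim = proj₂ ∃rank

  2+h+h≡2^m+2 : 2 + (2 ^ (m ∸ 1) + 2 ^ (m ∸ 1)) ≡ 2 ^ m + 2
  2+h+h≡2^m+2 = trans (+-comm 2 _) (cong (_+ 2) (sym (2^≡half+half m (≤-trans 1≤s s≤m))))

  hyperoval⇒d⊥ : HasHyperoval D (2 ^ m + 1) → d⊥ ≡ 2 ^ m + 2
  hyperoval⇒d⊥ hyp = trans (minDist-dual-hyperoval d⊥-min hyp) (sym (+-suc (2 ^ m) 1))

  no-hyperoval⇒d⊥ : ¬ HasHyperoval D (2 ^ m + 1) → 2 ^ m + 4 ≤ d⊥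
  no-hyperoval⇒d⊥ no-hyp = ≤-trans (≤-reflexive (+-comm (2 ^ m) 4))
    (≤-trans (≤-reflexive (cong (3 +_) (+-comm 1 (2 ^ m)))) (minDist-dual-no-hyperoval p₀ r-odd d⊥-min no-hyp))

theorem2p2 : (m s : ℕ) → 1 ≤ s → s ≤ m →
    (D : Steiner2Design (steinerLength m s) (2 ^ s)) →
    -- (i)
    (Code D full × DualCode D full) ×
    -- (ii)
    (∀ c e → DualCode D c → ∣ e ∣ ≤ 2 ^ (m ∸ 1) → majorityDecode D (c ⊕ e) ≡ c) ×
    -- (iii), (iv), (v)
    Σ ℕ (λ d⊥ → Σ ℕ (λ d → Σ ℕ (λ rk →
      (MinDist (DualCode D) d⊥ × 2 ∣ d⊥ ×
        (HasHyperoval D (2 ^ m + 1) → d⊥ ≡ 2 ^ m + 2) ×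
        (¬ HasHyperoval D (2 ^ m + 1) → 2 ^ m + 4 ≤ d⊥)) ×
      (MinDist (Code D) d × 2 ∣ d × d ≤ 2 ^ s) ×
      (Rank2 D rk ×
        (d⊥ ≡ 2 ^ m + 2 →
          1 + ⌈log₂ binomSum (steinerLength m s ∸ 1) (suc (2 ^ (m ∸ 1))) ⌉ ≤ rk) ×
        (2 ^ m + 4 ≤ d⊥ →
          1 + ⌈log₂ binomSum (steinerLength m s ∸ 1) (suc (d⊥ / 2 ∸ 1)) ⌉ ≤ rk) ×
        rk ≤ steinerLength m s ∸ 1 ∸ ⌊log₂ binomSum (steinerLength m s ∸ 1) (d / 2) ⌋))))
theorem2p2 m s 1≤s s≤m D =
    (full∈Code p₀ r-odd , full∈Dual k-even)
  , (λ c e c∈C⊥ → majority-decoding {c = c} {e} r≡h+h+1 c∈C⊥)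
  , d⊥ , d , rk
  , (d⊥-min , odd≡false⇒2∣ d⊥-even , hyperoval⇒d⊥ , no-hyperoval⇒d⊥)
  , (d-min , odd≡false⇒2∣ d-even , minDist-code≤k i₀ 1≤k d-min)
  , ( rk-dim
    , (λ d⊥≡2^m+2 → rank-lower-bound (2 ^ (m ∸ 1)) (block D) 1≤n rk-dim d⊥-min
                      (≤-reflexive (trans 2+h+h≡2^m+2 (sym d⊥≡2^m+2))))
    -- the bound holds for every even d⊥
    , (λ _ → rank-lower-bound-even (block D) 1≤n rk-dim d⊥-min d⊥-even)
    , rank-upper-bound (block D) 1≤n rk-dim d-min d-even)
  where open SteinerLengthDesign m s 1≤s s≤m D
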